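{- Let $A\in{\sf ASM}(n)$ and let $u\in\mathcal S_n$ be a Grassmannian permutation with descent at position $d$. If $r_A(d,j)\le r_u(d,j)$ for all $j=1,\ldots,n$, then $u\le A$.
   Context: An ASM of size $n$ is an $n\times n$ matrix $A=(a_{ij})$ with entries in $\{ -1,0,1\}$ whose nonzero entries alternate in sign along each row and column and each row and column sums to 1. $r_A(i,j)=\sum_{k\le i,\,l\le j}a_{kl}$. Permutations are identified with permutation matrices (1 at $(i,w(i))$). Order: $A\le B$ iff $r_A\ge r_B$ entrywise. A permutation is Grassmannian if it has exactly one descent (a position $i$ with $w(i)>w(i+1)$). -}

module Defs where

open import Data.Nat using (ℕ; zero; suc; _<ᵇ_)
import Data.Fin
import Data.Integer
import Data.Nat
open import Data.Fin using (Fin; toℕ; _≟_)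
open import Data.Fin.Permutation using (Permutation′; _⟨$⟩ʳ_)
open import Data.Integer using (ℤ; +_; -_; _+_; _*_; _≤_)
open import Data.List using (List; []; _∷_; filter; map; allFin)
open import Data.Bool using (if_then_else_)
open import Data.Product using (Σ; _×_; ∃)
open import Data.Sum using (_⊎_)
open import Relation.Nullary using (¬_; does; ¬?)
open import Relation.Binary.PropositionalEquality using (_≡_; _≢_)

Matrix : ℕ → Set
Matrix n = Fin n → Fin n → ℤ

Σᶠ : ∀ {n} → (Fin n → ℤ) → ℤ
Σᶠ {zero} f = + 0
Σᶠ {suc n} f = f Data.Fin.zero + Σᶠ (λ i → f (Data.Fin.suc i))

nonzeros : List ℤ → List ℤ
nonzeros = filter (λ x → ¬? (x Data.Integer.≟ + 0))

data Alternates : List ℤ → Set where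
  alt-[] : Alternates []
  alt-[x] : ∀ {x} → Alternates (x ∷ [])
  alt-∷ : ∀ {x y xs} → x * y ≡ - (+ 1) → Alternates (y ∷ xs) → Alternates (x ∷ y ∷ xs)

row : ∀ {n} → Matrix n → Fin n → List ℤ
row {n} A i = map (λ j → A i j) (allFin n)

col : ∀ {n} → Matrix n → Fin n → List ℤ
col {n} A j = map (λ i → A i j) (allFin n)

IsASM : ∀ {n} → Matrix n → Set
IsASM {n} A =
  (∀ i j → (A i j ≡ - (+ 1)) ⊎ ((A i j ≡ + 0) ⊎ (A i j ≡ + 1))) ×
  (∀ i → Alternates (nonzeros (row A i))) ×
  (∀ j → Alternates (nonzeros (col A j))) ×
  (∀ i → Σᶠ (λ j → A i j) ≡ + 1) ×
  (∀ j → Σᶠ (λ i → A i j) ≡ + 1)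

permMatrix : ∀ {n} → Permutation′ n → Matrix n
permMatrix w i j = if does ((w ⟨$⟩ʳ i) ≟ j) then + 1 else + 0

-- rank function r_A(i,j) = Σ_{k ≤ i, l ≤ j} a_{kl}, with 1-indexed i j
-- (0-indexed rows k with toℕ k < i, columns l with toℕ l < j)
rk : ∀ {n} → Matrix n → ℕ → ℕ → ℤ
rk A i j = Σᶠ (λ k → Σᶠ (λ l →
  if (toℕ k <ᵇ i) then (if (toℕ l <ᵇ j) then A k l else + 0) else + 0))

-- Bruhat order on ASMs: A ≤ B iff r_A ≥ r_B entrywise (i, j ∈ {1..n})
_≤ᴬ_ : ∀ {n} → Matrix n → Matrix n → Set
_≤ᴬ_ {n} A B = (i j : Fin n) → rk B (suc (toℕ i)) (suc (toℕ j)) ≤ rk A (suc (toℕ i)) (suc (toℕ j))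

-- w has a descent at 1-indexed position d: w(d) > w(d+1)
IsDescent : ∀ {n} → Permutation′ n → ℕ → Set
IsDescent {n} w d = Σ (Fin n) λ i → Σ (Fin n) λ i' →
  (suc (toℕ i) ≡ d) × (toℕ i' ≡ d) × (toℕ (w ⟨$⟩ʳ i') Data.Nat.< toℕ (w ⟨$⟩ʳ i))

GrassmannianAt : ∀ {n} → Permutation′ n → ℕ → Set
GrassmannianAt w d = IsDescent w d × (∀ e → IsDescent w e → e ≡ d)

module Submission where

-- Fix a column bound J and write a(i) = r_A(i,J), r(i) = r_u(i,J).
-- Both grow row by row: a(i+1) = a(i) + (prefix of row i of A up to J) and
-- r(i+1) = r(i) + [u(i) < J].  Every row and column of an ASM has all prefix
-- sums in {0,1}, hence a(i) ≤ i, a(i) ≤ J and a is weakly increasing.  A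
-- Grassmannian u with descent at d is increasing on rows < d and on rows ≥ d.
-- Starting from the hypothesis a(d) ≤ r(d) we propagate a ≤ r:
--   * downwards (row k < d): if u(k) < J then all earlier rows also hit a column
--     < J, so r(k) = k ≥ a(k); otherwise r(k) = r(k+1) ≥ a(k+1) ≥ a(k);
--   * upwards (row k ≥ d): if u(k) < J then r gains 1 while a gains at most 1;
--     otherwise every column < J is hit by a row ≤ k, so r(k+1) = J ≥ a(k+1).

open import Defs
open import Data.Nat as N using (ℕ; zero; suc; _<ᵇ_; z≤n; s≤s)
import Data.Nat.Properties as NP
open import Data.Fin as F using (Fin; toℕ)
import Data.Fin.Properties as FP
open import Data.Fin.Permutation using (Permutation′; _⟨$⟩ʳ_; _⟨$⟩ˡ_; inverseˡ; inverseʳ)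
open import Data.Integer as Z using (ℤ; +_; -_; _+_; _*_; _≤_)
import Data.Integer.Properties as ZP
open import Algebra.Properties.CommutativeMonoid.Sum ZP.+-0-commutativeMonoid
  using (sum; sum-cong-≗; ∑-comm)
open import Data.List using (_∷_; map; allFin; tabulate)
import Data.List.Properties as LP
open import Data.Bool using (Bool; true; false; if_then_else_)
open import Data.Product using (Σ; _×_; _,_; proj₁; proj₂)
open import Data.Sum using (_⊎_; inj₁; inj₂)
open import Data.Empty using (⊥-elim)
open import Relation.Nullary using (¬_; Dec; yes; no; does)
open import Relation.Binary using (tri<; tri≈; tri>)
open import Relation.Binary.PropositionalEquality

Σᶠ≡sum : ∀ {n} (f : Fin n → ℤ) → Σᶠ f ≡ sum f
Σᶠ≡sum {zero} f = refl
Σᶠ≡sum {suc n} f = cong (_+_ (f F.zero)) (Σᶠ≡sum (λ i → f (F.suc i)))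

Σᶠ-zero : ∀ n → Σᶠ {n} (λ _ → + 0) ≡ + 0
Σᶠ-zero zero = refl
Σᶠ-zero (suc n) = cong (_+_ (+ 0)) (Σᶠ-zero n)

Σᶠ-cong : ∀ {n} {f g : Fin n → ℤ} → (∀ i → f i ≡ g i) → Σᶠ f ≡ Σᶠ g
Σᶠ-cong {f = f} {g} f≗g = trans (Σᶠ≡sum f) (trans (sum-cong-≗ f≗g) (sym (Σᶠ≡sum g)))

Σᶠ-comm : ∀ {m n} (h : Fin m → Fin n → ℤ) →
  Σᶠ (λ k → Σᶠ (h k)) ≡ Σᶠ (λ l → Σᶠ (λ k → h k l))
Σᶠ-comm h = begin
  Σᶠ (λ k → Σᶠ (h k))            ≡⟨ Σᶠ≡sum (λ k → Σᶠ (h k)) ⟩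
  sum (λ k → Σᶠ (h k))           ≡⟨ sum-cong-≗ (λ k → Σᶠ≡sum (h k)) ⟩
  sum (λ k → sum (h k))          ≡⟨ ∑-comm h ⟩
  sum (λ l → sum (λ k → h k l))  ≡⟨ sum-cong-≗ (λ l → Σᶠ≡sum (λ k → h k l)) ⟨
  sum (λ l → Σᶠ (λ k → h k l))   ≡⟨ Σᶠ≡sum (λ l → Σᶠ (λ k → h k l)) ⟨
  Σᶠ (λ l → Σᶠ (λ k → h k l))    ∎
  where open ≡-Reasoning

Σᶠ-if : ∀ {n} (b : Bool) (g : Fin n → ℤ) →
  Σᶠ (λ l → if b then g l else + 0) ≡ (if b then Σᶠ g else + 0)
Σᶠ-if true g = refl
Σᶠ-if {n} false g = Σᶠ-zero n

-- Prefix sums: prefix f j = Σ_{l < j} f l.  Note that, definitionally,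
-- prefix f (suc j) = f zero + prefix (f ∘ suc) j.

prefix : ∀ {n} → (Fin n → ℤ) → ℕ → ℤ
prefix f j = Σᶠ (λ l → if toℕ l <ᵇ j then f l else + 0)

prefix-zero : ∀ {n} (f : Fin n → ℤ) → prefix f 0 ≡ + 0
prefix-zero {n} f = Σᶠ-zero n

prefix-full : ∀ {n} (f : Fin n → ℤ) → prefix f n ≡ Σᶠ f
prefix-full {zero} f = refl
prefix-full {suc n} f = cong (_+_ (f F.zero)) (prefix-full (λ l → f (F.suc l)))

prefix-step : ∀ {n} (f : Fin n → ℤ) (k : Fin n) →
  prefix f (suc (toℕ k)) ≡ prefix f (toℕ k) + f k
prefix-step f F.zero = begin
  f F.zero + prefix (λ l → f (F.suc l)) 0  ≡⟨ cong (_+_ (f F.zero)) (prefix-zero (λ l → f (F.suc l))) ⟩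
  f F.zero + + 0                           ≡⟨ ZP.+-comm (f F.zero) (+ 0) ⟩
  + 0 + f F.zero                           ≡⟨ cong (_+ f F.zero) (prefix-zero f) ⟨
  prefix f 0 + f F.zero                    ∎
  where open ≡-Reasoning
prefix-step f (F.suc k) =
  trans (cong (_+_ (f F.zero)) (prefix-step (λ l → f (F.suc l)) k))
        (sym (ZP.+-assoc (f F.zero) _ _))

prefix-≤-length : ∀ {n} (f : Fin n → ℤ) → (∀ k → f k ≤ + 1) → ∀ j → prefix f j ≤ + j
prefix-≤-length {zero} f f≤1 j = Z.+≤+ z≤n
prefix-≤-length {suc n} f f≤1 zero = ZP.≤-reflexive (prefix-zero f)
prefix-≤-length {suc n} f f≤1 (suc j) =
  ZP.+-mono-≤ (f≤1 F.zero) (prefix-≤-length (λ l → f (F.suc l)) (λ l → f≤1 (F.suc l)) j)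

prefix-ones : ∀ {n} (f : Fin n → ℤ) j → j N.≤ n → (∀ k → toℕ k N.< j → f k ≡ + 1) →
  prefix f j ≡ + j
prefix-ones f zero j≤n ones = prefix-zero f
prefix-ones f (suc j) (s≤s j≤n) ones =
  cong₂ _+_ (ones F.zero (s≤s z≤n))
            (prefix-ones (λ l → f (F.suc l)) j j≤n (λ k k<j → ones (F.suc k) (s≤s k<j)))

Indicator : ∀ {n} → (Fin n → ℤ) → Fin n → Set
Indicator f c = (f c ≡ + 1) × (∀ l → l ≢ c → f l ≡ + 0)

indicator-suc : ∀ {n} {f : Fin (suc n) → ℤ} {c} → Indicator f (F.suc c) →
  Indicator (λ l → f (F.suc l)) c
indicator-suc (at-c , off-c) = at-c , λ l l≢c → off-c (F.suc l) (λ eq → l≢c (FP.suc-injective eq))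

prefix-all-zero : ∀ {n} (f : Fin n → ℤ) → (∀ l → f l ≡ + 0) → ∀ j → prefix f j ≡ + 0
prefix-all-zero {zero} f zeros j = refl
prefix-all-zero {suc n} f zeros zero = prefix-zero f
prefix-all-zero {suc n} f zeros (suc j) =
  cong₂ _+_ (zeros F.zero) (prefix-all-zero (λ l → f (F.suc l)) (λ l → zeros (F.suc l)) j)

prefix-before : ∀ {n} (f : Fin n → ℤ) c → Indicator f c → ∀ j → j N.≤ toℕ c → prefix f j ≡ + 0
prefix-before f c ind zero j≤c = prefix-zero f
prefix-before f (F.suc c) ind (suc j) (s≤s j≤c) =
  cong₂ _+_ (proj₂ ind F.zero (λ ())) (prefix-before (λ l → f (F.suc l)) c (indicator-suc ind) j j≤c)

prefix-after : ∀ {n} (f : Fin n → ℤ) c → Indicator f c → ∀ j → toℕ c N.< j → prefix f j ≡ + 1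
prefix-after f F.zero (at-c , off-c) (suc j) c<j =
  cong₂ _+_ at-c (prefix-all-zero (λ l → f (F.suc l)) (λ l → off-c (F.suc l) (λ ())) j)
prefix-after f (F.suc c) ind (suc j) (s≤s c<j) =
  trans (cong₂ _+_ (proj₂ ind F.zero (λ ())) (prefix-after (λ l → f (F.suc l)) c (indicator-suc ind) j c<j))
        (ZP.+-identityˡ (+ 1))

rk-by-rows : ∀ {n} (M : Matrix n) i j → rk M i j ≡ prefix (λ k → prefix (M k) j) i
rk-by-rows M i j = Σᶠ-cong (λ k → Σᶠ-if (toℕ k <ᵇ i) (λ l → if toℕ l <ᵇ j then M k l else + 0))

rk-by-cols : ∀ {n} (M : Matrix n) i j → rk M i j ≡ prefix (λ l → prefix (λ k → M k l) i) j
rk-by-cols M i j =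
  trans (Σᶠ-comm (λ k l → if toℕ k <ᵇ i then (if toℕ l <ᵇ j then M k l else + 0) else + 0))
        (Σᶠ-cong (λ l → trans (Σᶠ-cong (λ k → swap-guards (toℕ k <ᵇ i) (toℕ l <ᵇ j) (M k l)))
                              (Σᶠ-if (toℕ l <ᵇ j) (λ k → if toℕ k <ᵇ i then M k l else + 0))))
  where
  swap-guards : (b c : Bool) (x : ℤ) →
    (if b then (if c then x else + 0) else + 0) ≡ (if c then (if b then x else + 0) else + 0)
  swap-guards true c x = refl
  swap-guards false true x = refl
  swap-guards false false x = refl

rk-step : ∀ {n} (M : Matrix n) (k : Fin n) j →
  rk M (suc (toℕ k)) j ≡ rk M (toℕ k) j + prefix (M k) j
rk-step M k j = begin
  rk M (suc (toℕ k)) j                  ≡⟨ rk-by-rows M (suc (toℕ k)) j ⟩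
  prefix row-sums (suc (toℕ k))         ≡⟨ prefix-step row-sums k ⟩
  prefix row-sums (toℕ k) + row-sums k  ≡⟨ cong (_+ row-sums k) (rk-by-rows M (toℕ k) j) ⟨
  rk M (toℕ k) j + row-sums k           ∎
  where
  open ≡-Reasoning
  row-sums : Fin _ → ℤ
  row-sums k′ = prefix (M k′) j

-- A line is a function f : Fin n → ℤ with
-- entries in {-1,0,1} whose nonzero entries alternate in sign; its prefix sums
-- stay in {0, x} where x is its first nonzero entry.

Entry : ℤ → Set
Entry x = (x ≡ - (+ 1)) ⊎ ((x ≡ + 0) ⊎ (x ≡ + 1))

Sign : ℤ → Set
Sign c = (c ≡ + 1) ⊎ (c ≡ - (+ 1))

ZeroOr : ℤ → ℤ → Set
ZeroOr x s = (s ≡ + 0) ⊎ (s ≡ x)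

opposite-sign : ∀ {c x} → Sign c → Entry x → c * x ≡ - (+ 1) → x ≡ - c
opposite-sign (inj₁ refl) (inj₁ refl) _ = refl
opposite-sign (inj₁ refl) (inj₂ (inj₁ refl)) ()
opposite-sign (inj₁ refl) (inj₂ (inj₂ refl)) ()
opposite-sign (inj₂ refl) (inj₁ refl) ()
opposite-sign (inj₂ refl) (inj₂ (inj₁ refl)) ()
opposite-sign (inj₂ refl) (inj₂ (inj₂ refl)) _ = refl

nonzero-sign : ∀ {x} → Entry x → x ≢ + 0 → Sign x
nonzero-sign (inj₁ x≡-1) _ = inj₂ x≡-1
nonzero-sign (inj₂ (inj₁ x≡0)) x≢0 = ⊥-elim (x≢0 x≡0)
nonzero-sign (inj₂ (inj₂ x≡1)) _ = inj₁ x≡1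

cancel-or-keep : ∀ x s → ZeroOr (- x) s → ZeroOr x (x + s)
cancel-or-keep x s (inj₁ refl) = inj₂ (ZP.+-identityʳ x)
cancel-or-keep x s (inj₂ refl) = inj₁ (ZP.+-inverseʳ x)

skip-zero : ∀ x s → ZeroOr x s → ZeroOr x (+ 0 + s)
skip-zero x s p rewrite ZP.+-identityˡ s = p

prefix-after-sign : ∀ {n} (f : Fin n → ℤ) c → Sign c → (∀ l → Entry (f l)) →
  Alternates (c ∷ nonzeros (tabulate f)) → ∀ j → ZeroOr (- c) (prefix f j)
prefix-after-sign {zero} f c c± entries alt j = inj₁ refl
prefix-after-sign {suc n} f c c± entries alt zero = inj₁ (prefix-zero f)
prefix-after-sign {suc n} f c c± entries alt (suc j) with f F.zero Z.≟ + 0 | alt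
... | yes f₀≡0 | alt′ rewrite f₀≡0 =
  skip-zero (- c) _ (prefix-after-sign (λ l → f (F.suc l)) c c± (λ l → entries (F.suc l)) alt′ j)
... | no f₀≢0 | alt-∷ c*f₀≡-1 alt′ =
  subst (λ x → ZeroOr x (f F.zero + prefix (λ l → f (F.suc l)) j))
        (opposite-sign c± (entries F.zero) c*f₀≡-1)
        (cancel-or-keep (f F.zero) _
          (prefix-after-sign (λ l → f (F.suc l)) (f F.zero) (nonzero-sign (entries F.zero) f₀≢0)
                             (λ l → entries (F.suc l)) alt′ j))

prefix-alternating : ∀ {n} (f : Fin n → ℤ) → (∀ l → Entry (f l)) →
  Alternates (nonzeros (tabulate f)) → Σ ℤ λ x → ∀ j → ZeroOr x (prefix f j)
prefix-alternating {zero} f entries alt = + 0 , λ j → inj₁ refl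
prefix-alternating {suc n} f entries alt with f F.zero Z.≟ + 0 | alt
... | yes f₀≡0 | alt′ =
  let (x , tail-sums) = prefix-alternating (λ l → f (F.suc l)) (λ l → entries (F.suc l)) alt′
  in x , λ { zero → inj₁ (prefix-zero f)
           ; (suc j) → subst (λ y → ZeroOr x (y + prefix (λ l → f (F.suc l)) j)) (sym f₀≡0)
                             (skip-zero x _ (tail-sums j)) }
... | no f₀≢0 | alt′ =
  f F.zero , λ { zero → inj₁ (prefix-zero f)
               ; (suc j) → cancel-or-keep (f F.zero) _
                   (prefix-after-sign (λ l → f (F.suc l)) (f F.zero) (nonzero-sign (entries F.zero) f₀≢0)
                                      (λ l → entries (F.suc l)) alt′ j) }

line-prefix-bounds : ∀ {n} (f : Fin n → ℤ) → (∀ l → Entry (f l)) →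
  Alternates (nonzeros (tabulate f)) → Σᶠ f ≡ + 1 →
  ∀ j → (+ 0 ≤ prefix f j) × (prefix f j ≤ + 1)
line-prefix-bounds {n} f entries alt total≡1 j with prefix-alternating f entries alt
... | x , sums with sums n
...   | inj₁ total≡0 = ⊥-elim (one≢zero (trans (sym total≡1) (trans (sym (prefix-full f)) total≡0)))
  where
  one≢zero : + 1 ≢ + 0
  one≢zero ()
...   | inj₂ total≡x with sums j
...     | inj₁ s≡0 rewrite s≡0 = ZP.≤-refl , Z.+≤+ z≤n
...     | inj₂ s≡x rewrite s≡x | sym total≡x | prefix-full f | total≡1 = Z.+≤+ z≤n , ZP.≤-refl

module _ {n} {A : Matrix n} (asm : IsASM A) where

  private
    entries : ∀ k l → Entry (A k l)
    entries = proj₁ asm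
    rows-alternate : ∀ k → Alternates (nonzeros (row A k))
    rows-alternate = proj₁ (proj₂ asm)
    cols-alternate : ∀ l → Alternates (nonzeros (col A l))
    cols-alternate = proj₁ (proj₂ (proj₂ asm))
    row-sums : ∀ k → Σᶠ (A k) ≡ + 1
    row-sums = proj₁ (proj₂ (proj₂ (proj₂ asm)))
    col-sums : ∀ l → Σᶠ (λ k → A k l) ≡ + 1
    col-sums = proj₂ (proj₂ (proj₂ (proj₂ asm)))

    as-tabulate : (f : Fin n → ℤ) → nonzeros (map f (allFin n)) ≡ nonzeros (tabulate f)
    as-tabulate f = cong nonzeros (LP.map-tabulate (λ l → l) f)

  row-prefix-bounds : ∀ k j → (+ 0 ≤ prefix (A k) j) × (prefix (A k) j ≤ + 1)
  row-prefix-bounds k = line-prefix-bounds (A k) (entries k)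
    (subst Alternates (as-tabulate (A k)) (rows-alternate k)) (row-sums k)

  col-prefix-bounds : ∀ l i → (+ 0 ≤ prefix (λ k → A k l) i) × (prefix (λ k → A k l) i ≤ + 1)
  col-prefix-bounds l = line-prefix-bounds (λ k → A k l) (λ k → entries k l)
    (subst Alternates (as-tabulate (λ k → A k l)) (cols-alternate l)) (col-sums l)

  -- r_A(i,j) ≤ i, since each of the first i rows contributes at most 1.
  rk-≤-rows : ∀ i j → rk A i j ≤ + i
  rk-≤-rows i j = subst (_≤ + i) (sym (rk-by-rows A i j))
    (prefix-≤-length (λ k → prefix (A k) j) (λ k → proj₂ (row-prefix-bounds k j)) i)

  -- r_A(i,j) ≤ j, since each of the first j columns contributes at most 1.
  rk-≤-cols : ∀ i j → rk A i j ≤ + j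
  rk-≤-cols i j = subst (_≤ + j) (sym (rk-by-cols A i j))
    (prefix-≤-length (λ l → prefix (λ k → A k l) i) (λ l → proj₂ (col-prefix-bounds l i)) j)

  rk-grows : ∀ k j → rk A (toℕ k) j ≤ rk A (suc (toℕ k)) j
  rk-grows k j = begin
    rk A (toℕ k) j                    ≡⟨ ZP.+-identityʳ (rk A (toℕ k) j) ⟨
    rk A (toℕ k) j + + 0              ≤⟨ ZP.+-monoʳ-≤ (rk A (toℕ k) j) (proj₁ (row-prefix-bounds k j)) ⟩
    rk A (toℕ k) j + prefix (A k) j   ≡⟨ rk-step A k j ⟨
    rk A (suc (toℕ k)) j              ∎
    where open ZP.≤-Reasoning

  rk-grows-by-≤1 : ∀ k j → rk A (suc (toℕ k)) j ≤ rk A (toℕ k) j + + 1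
  rk-grows-by-≤1 k j = subst (_≤ rk A (toℕ k) j + + 1) (sym (rk-step A k j))
    (ZP.+-monoʳ-≤ (rk A (toℕ k) j) (proj₂ (row-prefix-bounds k j)))

module _ {n} (u : Permutation′ n) where

  private
    P : Matrix n
    P = permMatrix u

    indicator-at : ∀ {a} {Q : Set a} (q : Dec Q) → Q → (if does q then + 1 else + 0) ≡ + 1
    indicator-at (yes _) _ = refl
    indicator-at (no ¬q) q = ⊥-elim (¬q q)

    indicator-off : ∀ {a} {Q : Set a} (q : Dec Q) → ¬ Q → (if does q then + 1 else + 0) ≡ + 0
    indicator-off (yes q) ¬q = ⊥-elim (¬q q)
    indicator-off (no _) _ = refl

  row-indicator : ∀ k → Indicator (P k) (u ⟨$⟩ʳ k)
  row-indicator k = indicator-at ((u ⟨$⟩ʳ k) F.≟ (u ⟨$⟩ʳ k)) refl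
                  , λ l l≢uk → indicator-off ((u ⟨$⟩ʳ k) F.≟ l) (λ uk≡l → l≢uk (sym uk≡l))

  col-indicator : ∀ l → Indicator (λ k → P k l) (u ⟨$⟩ˡ l)
  col-indicator l = indicator-at ((u ⟨$⟩ʳ (u ⟨$⟩ˡ l)) F.≟ l) (inverseʳ u)
                  , λ k k≢u⁻¹l → indicator-off ((u ⟨$⟩ʳ k) F.≟ l)
                      (λ uk≡l → k≢u⁻¹l (trans (sym (inverseˡ u)) (cong (u ⟨$⟩ˡ_) uk≡l)))

  perm-rk-rows : ∀ i j → i N.≤ n → (∀ k → toℕ k N.< i → toℕ (u ⟨$⟩ʳ k) N.< j) →
    rk P i j ≡ + i
  perm-rk-rows i j i≤n hits = trans (rk-by-rows P i j)
    (prefix-ones (λ k → prefix (P k) j) i i≤n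
      (λ k k<i → prefix-after (P k) (u ⟨$⟩ʳ k) (row-indicator k) j (hits k k<i)))

  perm-rk-cols : ∀ i j → j N.≤ n → (∀ l → toℕ l N.< j → toℕ (u ⟨$⟩ˡ l) N.< i) →
    rk P i j ≡ + j
  perm-rk-cols i j j≤n hits = trans (rk-by-cols P i j)
    (prefix-ones (λ l → prefix (λ k → P k l) i) j j≤n
      (λ l l<j → prefix-after (λ k → P k l) (u ⟨$⟩ˡ l) (col-indicator l) i (hits l l<j)))

  perm-rk-step-hit : ∀ k j → toℕ (u ⟨$⟩ʳ k) N.< j → rk P (suc (toℕ k)) j ≡ rk P (toℕ k) j + + 1
  perm-rk-step-hit k j uk<j =
    trans (rk-step P k j) (cong (_+_ (rk P (toℕ k) j)) (prefix-after (P k) (u ⟨$⟩ʳ k) (row-indicator k) j uk<j))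

  perm-rk-step-miss : ∀ k j → j N.≤ toℕ (u ⟨$⟩ʳ k) → rk P (suc (toℕ k)) j ≡ rk P (toℕ k) j
  perm-rk-step-miss k j j≤uk =
    trans (rk-step P k j)
          (trans (cong (_+_ (rk P (toℕ k) j)) (prefix-before (P k) (u ⟨$⟩ʳ k) (row-indicator k) j j≤uk))
                 (ZP.+-identityʳ (rk P (toℕ k) j)))

increasing-on-window : ∀ {n} (w : Fin n → ℕ) (lo hi : ℕ) →
  (∀ p q → lo N.≤ toℕ p → toℕ q ≡ suc (toℕ p) → toℕ q N.< hi → w p N.< w q) →
  ∀ p q → lo N.≤ toℕ p → toℕ p N.< toℕ q → toℕ q N.< hi → w p N.< w q
increasing-on-window {n} w lo hi ascent p q lo≤p p<q q<hi = go (toℕ q) q refl p<q q<hi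
  where
  go : ∀ m q → toℕ q ≡ m → toℕ p N.< m → m N.< hi → w p N.< w q
  go (suc m) q q≡m+1 (s≤s p≤m) m+1<hi with NP.m≤n⇒m<n∨m≡n p≤m
  ... | inj₂ p≡m = ascent p q lo≤p (trans q≡m+1 (cong suc (sym p≡m))) (subst (N._< hi) (sym q≡m+1) m+1<hi)
  ... | inj₁ p<m = NP.<-trans (go m q′ q′≡m p<m (NP.<-trans (NP.n<1+n m) m+1<hi))
                              (ascent q′ q lo≤q′ (trans q≡m+1 (cong suc (sym q′≡m)))
                                      (subst (N._< hi) (sym q≡m+1) m+1<hi))
    where
    m<n : m N.< n
    m<n = NP.<-trans (NP.n<1+n m) (subst (N._< n) q≡m+1 (FP.toℕ<n q))
    q′ : Fin n
    q′ = F.fromℕ< m<n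
    q′≡m : toℕ q′ ≡ m
    q′≡m = FP.toℕ-fromℕ< m<n
    lo≤q′ : lo N.≤ toℕ q′
    lo≤q′ = subst (lo N.≤_) (sym q′≡m) (NP.≤-trans lo≤p (NP.<⇒≤ p<m))

module _ {n} (u : Permutation′ n) {d : ℕ} (grassmannian : GrassmannianAt u d) where

  private
    U : Fin n → ℕ
    U k = toℕ (u ⟨$⟩ʳ k)

  ascent-off-descent : ∀ p q → toℕ q ≡ suc (toℕ p) → toℕ q ≢ d → U p N.< U q
  ascent-off-descent p q q≡p+1 q≢d with NP.<-cmp (U p) (U q)
  ... | tri< up<uq _ _ = up<uq
  ... | tri≈ _ up≡uq _ = ⊥-elim (NP.1+n≢n (sym (trans (cong toℕ p≡q) q≡p+1)))
    where
    p≡q : p ≡ q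
    p≡q = trans (sym (inverseˡ u)) (trans (cong (u ⟨$⟩ˡ_) (FP.toℕ-injective up≡uq)) (inverseˡ u))
  ... | tri> _ _ up>uq = ⊥-elim (q≢d (trans q≡p+1 (proj₂ grassmannian _ (p , q , refl , q≡p+1 , up>uq))))

  increasing-below : ∀ p q → toℕ p N.< toℕ q → toℕ q N.< d → U p N.< U q
  increasing-below p q = increasing-on-window U 0 d
    (λ p′ q′ _ q′≡p′+1 q′<d → ascent-off-descent p′ q′ q′≡p′+1 (NP.<⇒≢ q′<d)) p q z≤n

  increasing-above : ∀ p q → d N.≤ toℕ p → toℕ p N.< toℕ q → U p N.< U q
  increasing-above p q d≤p p<q = increasing-on-window U d n
    (λ p′ q′ d≤p′ q′≡p′+1 _ → ascent-off-descent p′ q′ q′≡p′+1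
      (λ q′≡d → NP.<⇒≢ (s≤s d≤p′) (trans (sym q′≡d) q′≡p′+1)))
    p q d≤p p<q (FP.toℕ<n q)

  descent<n : d N.< n
  descent<n with proj₁ grassmannian
  ... | _ , i′ , _ , i′≡d , _ = subst (N._< n) i′≡d (FP.toℕ<n i′)

descend : ∀ {n} (Q : ℕ → Set) d → d N.< n →
  (∀ (k : Fin n) → toℕ k N.< d → Q (suc (toℕ k)) → Q (toℕ k)) →
  Q d → ∀ i → i N.≤ d → Q i
descend {n} Q d d<n step Qd i i≤d = go (d N.∸ i) i (NP.m+[n∸m]≡n i≤d)
  where
  step-at : ∀ i → i N.< d → Q (suc i) → Q i
  step-at i i<d with F.fromℕ< (NP.<-trans i<d d<n) | FP.toℕ-fromℕ< (NP.<-trans i<d d<n)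
  ... | k | refl = step k i<d

  go : ∀ t i → i N.+ t ≡ d → Q i
  go zero i i+0≡d = subst Q (trans (sym i+0≡d) (NP.+-identityʳ i)) Qd
  go (suc t) i i+t+1≡d = step-at i (subst (i N.<_) i+t+1≡d (NP.m<m+n i (s≤s z≤n)))
                                   (go t (suc i) (trans (sym (NP.+-suc i t)) i+t+1≡d))

ascend : ∀ {n} (Q : ℕ → Set) d →
  (∀ (k : Fin n) → d N.≤ toℕ k → Q (toℕ k) → Q (suc (toℕ k))) →
  Q d → ∀ i → d N.≤ i → i N.≤ n → Q i
ascend Q .zero step Qd zero z≤n _ = Qd
ascend Q d step Qd (suc i) d≤i+1 i<n with NP.m≤n⇒m<n∨m≡n d≤i+1
... | inj₂ refl = Qd
... | inj₁ (s≤s d≤i) with F.fromℕ< i<n | FP.toℕ-fromℕ< i<n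
...   | k | refl = step k d≤i (ascend Q d step Qd (toℕ k) d≤i (NP.<⇒≤ i<n))

module Column {n} (A : Matrix n) (asm : IsASM A) (u : Permutation′ n) {d : ℕ}
  (grassmannian : GrassmannianAt u d) (j : ℕ) (j≤n : j N.≤ n) where

  a r : ℕ → ℤ
  a i = rk A i j
  r i = rk (permMatrix u) i j

  U : Fin n → ℕ
  U k = toℕ (u ⟨$⟩ʳ k)

  step-down : ∀ k → toℕ k N.< d → a (suc (toℕ k)) ≤ r (suc (toℕ k)) → a (toℕ k) ≤ r (toℕ k)
  step-down k k<d a≤r-next with U k N.<? j
  ... | yes uk<j = begin
    a (toℕ k)  ≤⟨ rk-≤-rows asm (toℕ k) j ⟩
    + toℕ k    ≡⟨ perm-rk-rows u (toℕ k) j (NP.<⇒≤ (FP.toℕ<n k)) earlier-rows-hit ⟨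
    r (toℕ k)  ∎
    where
    open ZP.≤-Reasoning
    earlier-rows-hit : ∀ k′ → toℕ k′ N.< toℕ k → U k′ N.< j
    earlier-rows-hit k′ k′<k = NP.<-trans (increasing-below u grassmannian k′ k k′<k k<d) uk<j
  ... | no uk≮j = begin
    a (toℕ k)        ≤⟨ rk-grows asm k j ⟩
    a (suc (toℕ k))  ≤⟨ a≤r-next ⟩
    r (suc (toℕ k))  ≡⟨ perm-rk-step-miss u k j (NP.≮⇒≥ uk≮j) ⟩
    r (toℕ k)        ∎
    where open ZP.≤-Reasoning

  step-up : ∀ k → d N.≤ toℕ k → a (toℕ k) ≤ r (toℕ k) → a (suc (toℕ k)) ≤ r (suc (toℕ k))
  step-up k d≤k a≤r with U k N.<? j
  ... | yes uk<j = begin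
    a (suc (toℕ k))  ≤⟨ rk-grows-by-≤1 asm k j ⟩
    a (toℕ k) + + 1  ≤⟨ ZP.+-monoˡ-≤ (+ 1) a≤r ⟩
    r (toℕ k) + + 1  ≡⟨ perm-rk-step-hit u k j uk<j ⟨
    r (suc (toℕ k))  ∎
    where open ZP.≤-Reasoning
  ... | no uk≮j = begin
    a (suc (toℕ k))  ≤⟨ rk-≤-cols asm (suc (toℕ k)) j ⟩
    + j              ≡⟨ perm-rk-cols u (suc (toℕ k)) j j≤n columns-hit ⟨
    r (suc (toℕ k))  ∎
    where
    open ZP.≤-Reasoning
    -- a column l < j hit by a later row would force u(k) < u(u⁻¹ l) = l < j
    columns-hit : ∀ l → toℕ l N.< j → toℕ (u ⟨$⟩ˡ l) N.< suc (toℕ k)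
    columns-hit l l<j with toℕ k N.<? toℕ (u ⟨$⟩ˡ l)
    ... | yes k<u⁻¹l = ⊥-elim (uk≮j (NP.<-trans uk<l l<j))
      where
      uk<l : U k N.< toℕ l
      uk<l = subst (U k N.<_) (cong toℕ (inverseʳ u)) (increasing-above u grassmannian k _ d≤k k<u⁻¹l)
    ... | no k≮u⁻¹l = s≤s (NP.≮⇒≥ k≮u⁻¹l)

  column-bound : a d ≤ r d → ∀ i → i N.≤ n → a i ≤ r i
  column-bound at-d i i≤n with NP.≤-total i d
  ... | inj₁ i≤d = descend (λ i → a i ≤ r i) d (descent<n u grassmannian) step-down at-d i i≤d
  ... | inj₂ d≤i = ascend (λ i → a i ≤ r i) d step-up at-d i d≤i i≤n

lemma3p12 : (n : ℕ) (A : Matrix n) → IsASM A →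
    (u : Permutation′ n) (d : ℕ) → GrassmannianAt u d →
    ((j : Fin n) → rk A d (suc (toℕ j)) ≤ rk (permMatrix u) d (suc (toℕ j))) →
    permMatrix u ≤ᴬ A
lemma3p12 n A asm u d grassmannian at-descent i j =
  Column.column-bound A asm u grassmannian (suc (toℕ j)) (FP.toℕ<n j) (at-descent j)
                      (suc (toℕ i)) (FP.toℕ<n i)
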